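{- Let $G$ be a finite graph with $\gamma_{1/2}(G)=3$, and let $P_m$ be the path on $m$ vertices ($m\ge 1$). Then $\gamma_{1/2}(G \square P_m) \geq 3\,\gamma_{1/2}(P_m)$.
   Context: For a graph $G=(V,E)$ and a vertex $v$, $N[v]$ denotes the closed neighborhood of $v$, and for $S\subseteq V$, $N[S]=\bigcup_{u\in S}N[u]$. For $p\in[0,1]$, a set $S\subseteq V$ is a $p$-dominating set if $|N[S]|/|V|\geq p$; $\gamma_p(G)$ is the minimum cardinality of a $p$-dominating set of $G$. $G\square H$ denotes the Cartesian product of graphs $G$ and $H$. -}

module Defs where

open import Data.Nat using (ℕ; zero; suc; _+_; _*_; _≤_)
open import Data.Bool using (Bool; true; false; _∧_; _∨_; not; T)
open import Data.Fin using (Fin; remQuot; toℕ)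
open import Data.Fin.Properties using (_≟_)
open import Data.Product using (_×_; _,_; proj₁; proj₂; Σ; ∃)
open import Data.Vec.Functional using (foldr)
open import Relation.Nullary.Decidable using (⌊_⌋)
open import Relation.Binary.PropositionalEquality using (_≡_; refl) renaming (sym to ≡sym)
open import Relation.Nullary using (yes; no)
open import Data.Empty using (⊥-elim)
open import Data.Bool.Properties using (∨-comm)
open import Data.Nat.Properties using (1+n≢n) renaming (_≟_ to _ℕ≟_)

record Graph : Set where
  field
    n     : ℕ
    adj   : Fin n → Fin n → Bool
    sym   : ∀ u v → adj u v ≡ adj v u
    irrefl : ∀ v → adj v v ≡ false
open Graph public

VSet : ℕ → Set
VSet k = Fin k → Bool

count : {k : ℕ} → (Fin k → Bool) → ℕ
count {k} f = foldr (λ b acc → (if' b) + acc) 0 f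
  where
  if' : Bool → ℕ
  if' true = 1
  if' false = 0

anyF : {k : ℕ} → (Fin k → Bool) → Bool
anyF f = foldr _∨_ false f

closedNbhd : (G : Graph) → VSet (n G) → VSet (n G)
closedNbhd G S v = anyF (λ u → S u ∧ (⌊ u ≟ v ⌋ ∨ adj G u v))

HalfDominating : (G : Graph) → VSet (n G) → Set
HalfDominating G S = n G ≤ 2 * count (closedNbhd G S)

γHalf≡ : Graph → ℕ → Set
γHalf≡ G k =
  (Σ (VSet (n G)) λ S → HalfDominating G S × count S ≡ k)
  × (∀ S → HalfDominating G S → k ≤ count S)

pathAdj : (m : ℕ) → Fin m → Fin m → Bool
pathAdj m i j = ⌊ suc (toℕ i) ℕ≟ toℕ j ⌋ ∨ ⌊ suc (toℕ j) ℕ≟ toℕ i ⌋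

pathAdj-sym : (m : ℕ) → ∀ i j → pathAdj m i j ≡ pathAdj m j i
pathAdj-sym m i j = ∨-comm ⌊ suc (toℕ i) ℕ≟ toℕ j ⌋ ⌊ suc (toℕ j) ℕ≟ toℕ i ⌋

pathAdj-irrefl : (m : ℕ) → ∀ i → pathAdj m i i ≡ false
pathAdj-irrefl m i with suc (toℕ i) ℕ≟ toℕ i
... | yes p = ⊥-elim (1+n≢n p)
... | no _ = refl

Path : ℕ → Graph
Path m = record { n = m ; adj = pathAdj m ; sym = pathAdj-sym m ; irrefl = pathAdj-irrefl m }

-- Cartesian product G □ H, vertex (g , h) encoded as an element of Fin (n G * n H)
-- via the standard bijection remQuot.
boxAdj' : (G H : Graph) → Fin (n G) × Fin (n H) → Fin (n G) × Fin (n H) → Bool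
boxAdj' G H (g , h) (g' , h') =
  (⌊ g ≟ g' ⌋ ∧ adj H h h') ∨ (⌊ h ≟ h' ⌋ ∧ adj G g g')

dec-sym : ∀ {k} (a b : Fin k) → ⌊ a ≟ b ⌋ ≡ ⌊ b ≟ a ⌋
dec-sym a b with a ≟ b | b ≟ a
... | yes _ | yes _ = refl
... | no _ | no _ = refl
... | yes p | no q = ⊥-elim (q (≡sym p))
... | no p | yes q = ⊥-elim (p (≡sym q))

box-sym : (G H : Graph) → ∀ x y → boxAdj' G H x y ≡ boxAdj' G H y x
box-sym G H (g , h) (g' , h')
  rewrite sym H h h' | sym G g g' | dec-sym g g' | dec-sym h h' = refl

box-irrefl : (G H : Graph) → ∀ x → boxAdj' G H x x ≡ false
box-irrefl G H (g , h) rewrite irrefl H h | irrefl G g with g ≟ g | h ≟ h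
... | yes _ | yes _ = refl
... | yes _ | no _ = refl
... | no _ | yes _ = refl
... | no _ | no _ = refl

_□_ : Graph → Graph → Graph
G □ H = record
  { n = n G * n H
  ; adj = λ x y → boxAdj' G H (remQuot (n H) x) (remQuot (n H) y)
  ; sym = λ x y → box-sym G H (remQuot (n H) x) (remQuot (n H) y)
  ; irrefl = λ x → box-irrefl G H (remQuot (n H) x)
  }

module Submission where

-- Since no two vertices ½-dominate G, every closed neighbourhood of G satisfies
-- 2|N[g]| + 3 ≤ |G| (compare N[g] with N[{g, w}] for a vertex w outside N[g]), so |G| ≥ 5.
-- In G □ P_m a vertex (g, h) has |N[(g, h)]| ≤ |N[g]| + 2, hence a ½-dominating set S of
-- G □ P_m satisfies |G| m ≤ 2 |N[S]| ≤ |S| (|G| + 1), so 5m ≤ 6|S|; and the projection of S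
-- onto G is ½-dominating, so |S| ≥ 3. On the other side P_m is ½-dominated by every sixth
-- vertex, so 6 γ_{1/2}(P_m) ≤ m + 5, and the three inequalities give 3 γ_{1/2}(P_m) ≤ |S|.

open import Defs hiding (sym)
open import Data.Bool using (Bool; true; false; T; _∧_; _∨_)
open import Data.Bool.Properties using (T-∧; T-∨; T?; ∧-identityʳ)
open import Data.Empty using (⊥-elim)
open import Data.Fin
  using (Fin; zero; suc; toℕ; fromℕ<; _↑ˡ_; _↑ʳ_; quotient; remainder; remQuot)
open import Data.Fin.Properties
  using ( _≟_; ¬∀⟶∃¬; remQuot-combine; splitAt-↑ʳ; toℕ-injective; 0≢1+n; suc-injective
        ; toℕ<n; toℕ-fromℕ<)
open import Data.Nat using (ℕ; zero; suc; _+_; _*_; _≤_; _<_; z≤n; s≤s; >-nonZero; _≤?_)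
open import Data.Nat.Properties
  using ( ≤-refl; ≤-reflexive; ≤-trans; ≤-<-trans; <-trans; ≤-pred; <⇒≱; ≰⇒>; ≤∧≢⇒<
        ; n<1+n; ≤ᵇ⇒≤; m≤n*m; +-mono-≤; +-monoˡ-≤; +-monoʳ-≤; +-mono-≤-<; *-monoˡ-≤
        ; *-monoʳ-≤; +-cancelˡ-≤; *-cancelʳ-≤; *-cancelˡ-<; +-assoc; +-comm; +-suc
        ; +-identityʳ; *-assoc; *-suc; *-zeroʳ; *-identityˡ; *-identityʳ; *-distribˡ-+
        ; *-distribʳ-+; +-commutativeSemigroup; module ≤-Reasoning )
  renaming (_≟_ to _ℕ≟_; suc-injective to ℕ-suc-injective)
open import Data.Nat.Tactic.RingSolver using (solve-∀)
open import Algebra.Properties.CommutativeSemigroup +-commutativeSemigroup using (interchange)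
open import Data.Product using (_×_; _,_; proj₁; proj₂; ∃; map₁)
open import Data.Sum using (inj₁; inj₂)
open import Function using (_∘_; Equivalence)
open import Relation.Binary.PropositionalEquality
  using (_≡_; refl; sym; trans; cong; cong₂; subst; subst₂; module ≡-Reasoning)
open import Relation.Nullary using (¬_; yes; no)
open import Relation.Nullary.Decidable using (⌊_⌋; toWitness; fromWitness)

open Equivalence using (to; from)

-- Counting subsets of Fin k

ind : Bool → ℕ
ind false = 0
ind true  = 1

ind-true : ∀ {b} → T b → ind b ≡ 1
ind-true {true} _ = refl

ind-false : ∀ {b} → ¬ T b → ind b ≡ 0
ind-false {false} _   = refl
ind-false {true}  b∉ = ⊥-elim (b∉ _)

ind-mono : ∀ {a b} → (T a → T b) → ind a ≤ ind b
ind-mono {false}         _   = z≤n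
ind-mono {true}  {true}  _   = ≤-refl
ind-mono {true}  {false} a⇒b = ⊥-elim (a⇒b _)

ind≤1 : ∀ b → ind b ≤ 1
ind≤1 false = z≤n
ind≤1 true  = ≤-refl

ind-∨ : ∀ a b → ind (a ∨ b) ≤ ind a + ind b
ind-∨ false _ = ≤-refl
ind-∨ true  _ = s≤s z≤n

module _ {k : ℕ} where

  ⁅_⁆ : Fin k → VSet k
  ⁅ v ⁆ u = ⌊ v ≟ u ⌋

  _∪_ : VSet k → VSet k → VSet k
  (A ∪ B) i = A i ∨ B i

  _⊆_ : VSet k → VSet k → Set
  A ⊆ B = ∀ i → T (A i) → T (B i)

∈⁅⁆ : ∀ {k} (v : Fin k) → T (⁅ v ⁆ v)
∈⁅⁆ v = fromWitness refl

count-suc : ∀ {k} (A : VSet (suc k)) → count A ≡ ind (A zero) + count (A ∘ suc)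
count-suc A with A zero
... | false = refl
... | true  = refl

count-cong : ∀ {k} {A B : VSet k} → (∀ i → A i ≡ B i) → count A ≡ count B
count-cong {zero}          _   = refl
count-cong {suc k} {A} {B} A≗B rewrite count-suc A | count-suc B | A≗B zero =
  cong (ind (B zero) +_) (count-cong (A≗B ∘ suc))

count-mono : ∀ {k} {A B : VSet k} → A ⊆ B → count A ≤ count B
count-mono {zero}          _   = z≤n
count-mono {suc k} {A} {B} A⊆B rewrite count-suc A | count-suc B =
  +-mono-≤ (ind-mono (A⊆B zero)) (count-mono (A⊆B ∘ suc))

count-mono-< : ∀ {k} {A B : VSet k} → A ⊆ B → ∀ w → ¬ T (A w) → T (B w) → count A < count B
count-mono-< {suc k} {A} {B} A⊆B zero w∉A w∈B
  rewrite count-suc A | count-suc B | ind-false w∉A | ind-true w∈B =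
  s≤s (count-mono (A⊆B ∘ suc))
count-mono-< {suc k} {A} {B} A⊆B (suc w) w∉A w∈B rewrite count-suc A | count-suc B =
  +-mono-≤-< (ind-mono (A⊆B zero)) (count-mono-< (A⊆B ∘ suc) w w∉A w∈B)

count≤size : ∀ {k} (A : VSet k) → count A ≤ k
count≤size {zero}  _ = z≤n
count≤size {suc k} A rewrite count-suc A =
  +-mono-≤ (ind≤1 (A zero)) (count≤size (A ∘ suc))

size≤count : ∀ {k} (A : VSet k) → (∀ i → T (A i)) → k ≤ count A
size≤count {zero}  _ _    = z≤n
size≤count {suc k} A full rewrite count-suc A | ind-true (full zero) =
  s≤s (size≤count (A ∘ suc) (full ∘ suc))

count<size⇒∃∉ : ∀ {k} (A : VSet k) → count A < k → ∃ λ w → ¬ T (A w)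
count<size⇒∃∉ {k} A <k = ¬∀⟶∃¬ k (T ∘ A) (T? ∘ A) (λ full → <⇒≱ <k (size≤count A full))

count-empty : ∀ {k} (A : VSet k) → (∀ i → ¬ T (A i)) → count A ≡ 0
count-empty {zero}  _ _     = refl
count-empty {suc k} A empty rewrite count-suc A | ind-false (empty zero) =
  count-empty (A ∘ suc) (empty ∘ suc)

count≤1 : ∀ {k} (A : VSet k) → (∀ i j → T (A i) → T (A j) → i ≡ j) → count A ≤ 1
count≤1 {zero}  _ _    = z≤n
count≤1 {suc k} A uniq rewrite count-suc A with T? (A zero)
... | yes 0∈A rewrite ind-true 0∈A
                    | count-empty (A ∘ suc) (λ i i∈A → 0≢1+n (uniq zero (suc i) 0∈A i∈A)) = ≤-refl
... | no  0∉A rewrite ind-false 0∉A =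
  count≤1 (A ∘ suc) (λ i j i∈A j∈A → suc-injective (uniq (suc i) (suc j) i∈A j∈A))

count-⁅⁆ : ∀ {k} (v : Fin k) → count ⁅ v ⁆ ≤ 1
count-⁅⁆ v = count≤1 ⁅ v ⁆ (λ i j v≡i v≡j → trans (sym (toWitness v≡i)) (toWitness v≡j))

count-∪ : ∀ {k} (A B : VSet k) → count (A ∪ B) ≤ count A + count B
count-∪ {zero}  _ _ = z≤n
count-∪ {suc k} A B rewrite count-suc (A ∪ B) | count-suc A | count-suc B = begin
  ind (A zero ∨ B zero) + count ((A ∪ B) ∘ suc)
    ≤⟨ +-mono-≤ (ind-∨ (A zero) (B zero)) (count-∪ (A ∘ suc) (B ∘ suc)) ⟩
  (ind (A zero) + ind (B zero)) + (count (A ∘ suc) + count (B ∘ suc))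
    ≡⟨ interchange (ind (A zero)) (ind (B zero)) _ _ ⟩
  (ind (A zero) + count (A ∘ suc)) + (ind (B zero) + count (B ∘ suc)) ∎
  where open ≤-Reasoning

count-true : ∀ {k} → count {k} (λ _ → true) ≡ k
count-true {zero}  = refl
count-true {suc k} = cong suc (count-true {k})

count-∧ˡ : ∀ {k} b (A : VSet k) → count (λ i → b ∧ A i) ≡ ind b * count A
count-∧ˡ     true  A = sym (+-identityʳ (count A))
count-∧ˡ {k} false A = count-empty {k} (λ _ → false) (λ _ ())

anyF-intro : ∀ {k} (A : VSet k) i → T (A i) → T (anyF A)
anyF-intro A zero    i∈A = from T-∨ (inj₁ i∈A)
anyF-intro A (suc i) i∈A = from (T-∨ {A zero}) (inj₂ (anyF-intro (A ∘ suc) i i∈A))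

anyF-elim : ∀ {k} (A : VSet k) → T (anyF A) → ∃ λ i → T (A i)
anyF-elim {suc k} A any with to (T-∨ {A zero}) any
... | inj₁ 0∈A  = zero , 0∈A
... | inj₂ any′ with anyF-elim (A ∘ suc) any′
...   | i , i∈A = suc i , i∈A

count-⋃ : ∀ {k l a b} (S : VSet k) (F : Fin k → VSet l) →
          (∀ u → T (S u) → a * count (F u) ≤ b) →
          a * count (λ v → anyF (λ u → S u ∧ F u v)) ≤ count S * b
count-⋃ {zero} {l} {a} _ _ _ =
  ≤-reflexive (trans (cong (a *_) (count-empty {l} _ λ _ ())) (*-zeroʳ a))
count-⋃ {suc k} {l} {a} {b} S F bound rewrite count-suc S = begin
  a * count (F₀ ∪ ⋃F′)
    ≤⟨ *-monoʳ-≤ a (count-∪ F₀ ⋃F′) ⟩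
  a * (count F₀ + count ⋃F′)
    ≡⟨ *-distribˡ-+ a (count F₀) (count ⋃F′) ⟩
  a * count F₀ + a * count ⋃F′
    ≤⟨ +-mono-≤ (head-bound (S zero) (bound zero))
                (count-⋃ {a = a} (S ∘ suc) (F ∘ suc) (bound ∘ suc)) ⟩
  ind (S zero) * b + count (S ∘ suc) * b
    ≡⟨ *-distribʳ-+ b (ind (S zero)) _ ⟨
  (ind (S zero) + count (S ∘ suc)) * b ∎
  where
  open ≤-Reasoning
  F₀ ⋃F′ : VSet l
  F₀ v  = S zero ∧ F zero v
  ⋃F′ v = anyF (λ u → S (suc u) ∧ F (suc u) v)
  head-bound : ∀ s → (T s → a * count (F zero) ≤ b) → a * count (λ v → s ∧ F zero v) ≤ ind s * b
  head-bound s s⇒bound rewrite count-∧ˡ s (F zero) with s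
  ... | true  = subst₂ _≤_ (cong (a *_) (sym (*-identityˡ _))) (sym (*-identityˡ b)) (s⇒bound _)
  ... | false = ≤-reflexive (*-zeroʳ a)

image : ∀ {k l} → (Fin k → Fin l) → VSet k → VSet l
image f S v = anyF (λ u → S u ∧ ⁅ f u ⁆ v)

count-image : ∀ {k l} (f : Fin k → Fin l) (S : VSet k) → count (image f S) ≤ count S
count-image f S =
  subst₂ _≤_ (*-identityˡ _) (*-identityʳ _)
    (count-⋃ {a = 1} S (⁅_⁆ ∘ f) λ u _ → subst (_≤ 1) (sym (*-identityˡ _)) (count-⁅⁆ (f u)))

count-++ : ∀ {a b} (A : VSet (a + b)) →
           count A ≡ count {a} (A ∘ (_↑ˡ b)) + count {b} (A ∘ (a ↑ʳ_))
count-++ {zero}      _ = refl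
count-++ {suc a} {b} A = begin
  count A
    ≡⟨ count-suc A ⟩
  ind (A zero) + count (A ∘ suc)
    ≡⟨ cong (ind (A zero) +_) (count-++ {a} (A ∘ suc)) ⟩
  ind (A zero) + (count {a} (A ∘ suc ∘ (_↑ˡ b)) + count {b} (A ∘ (suc a ↑ʳ_)))
    ≡⟨ +-assoc (ind (A zero)) _ _ ⟨
  ind (A zero) + count {a} (A ∘ suc ∘ (_↑ˡ b)) + count {b} (A ∘ (suc a ↑ʳ_))
    ≡⟨ cong (_+ count {b} (A ∘ (suc a ↑ʳ_))) (count-suc (A ∘ (_↑ˡ b))) ⟨
  count (A ∘ (_↑ˡ b)) + count (A ∘ (suc a ↑ʳ_)) ∎
  where open ≡-Reasoning

_⊠_ : ∀ {n m} → VSet n → VSet m → VSet (n * m)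
_⊠_ {n} {m} A B x = A (quotient {n} m x) ∧ B (remainder {n} m x)

⊠-↑ˡ : ∀ {n m} (A : VSet (suc n)) (B : VSet m) i → (A ⊠ B) (i ↑ˡ n * m) ≡ A zero ∧ B i
⊠-↑ˡ {n} A B i = cong (λ p → A (proj₁ p) ∧ B (proj₂ p)) (remQuot-combine {suc n} zero i)

⊠-↑ʳ : ∀ {n m} (A : VSet (suc n)) (B : VSet m) j → (A ⊠ B) (m ↑ʳ j) ≡ ((A ∘ suc) ⊠ B) j
⊠-↑ʳ {n} {m} A B j = cong (λ p → A (proj₁ p) ∧ B (proj₂ p)) remQuot-↑ʳ
  where
  remQuot-↑ʳ : remQuot {suc n} m (m ↑ʳ j) ≡ map₁ suc (remQuot {n} m j)
  remQuot-↑ʳ rewrite splitAt-↑ʳ m (n * m) j = refl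

count-⊠ : ∀ {n m} (A : VSet n) (B : VSet m) → count (A ⊠ B) ≡ count A * count B
count-⊠ {zero}      _ _ = refl
count-⊠ {suc n} {m} A B = begin
  count (A ⊠ B)
    ≡⟨ count-++ {m} (A ⊠ B) ⟩
  count {m} ((A ⊠ B) ∘ (_↑ˡ n * m)) + count {n * m} ((A ⊠ B) ∘ (m ↑ʳ_))
    ≡⟨ cong₂ _+_ (count-cong (⊠-↑ˡ A B)) (count-cong (⊠-↑ʳ A B)) ⟩
  count (λ i → A zero ∧ B i) + count ((A ∘ suc) ⊠ B)
    ≡⟨ cong₂ _+_ (count-∧ˡ (A zero) B) (count-⊠ (A ∘ suc) B) ⟩
  ind (A zero) * count B + count (A ∘ suc) * count B
    ≡⟨ *-distribʳ-+ (count B) (ind (A zero)) (count (A ∘ suc)) ⟨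
  (ind (A zero) + count (A ∘ suc)) * count B
    ≡⟨ cong (_* count B) (count-suc A) ⟨
  count A * count B ∎
  where open ≡-Reasoning

count-∘quotient : ∀ {n m} (A : VSet n) → count {n * m} (A ∘ quotient {n} m) ≡ count A * m
count-∘quotient {n} {m} A = begin
  count (A ∘ quotient m)             ≡⟨ count-cong (λ x → ∧-identityʳ (A (quotient m x))) ⟨
  count (A ⊠ λ _ → true)             ≡⟨ count-⊠ A (λ _ → true) ⟩
  count A * count {m} (λ _ → true)   ≡⟨ cong (count A *_) count-true ⟩
  count A * m                        ∎
  where open ≡-Reasoning

-- Closed neighbourhoods and ½-domination

vertexNbhd : (G : Graph) → Fin (n G) → VSet (n G)
vertexNbhd G v = ⁅ v ⁆ ∪ adj G v

∈vertexNbhd : (G : Graph) (v : Fin (n G)) → T (vertexNbhd G v v)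
∈vertexNbhd G v = from T-∨ (inj₁ (∈⁅⁆ v))

vertexNbhd⊆closedNbhd : (G : Graph) (S : VSet (n G)) {v : Fin (n G)} → T (S v) →
                        vertexNbhd G v ⊆ closedNbhd G S
vertexNbhd⊆closedNbhd G S {v} v∈S u u∈N[v] = anyF-intro _ v (from T-∧ (v∈S , u∈N[v]))

count-closedNbhd : ∀ {a b} (G : Graph) → (∀ v → a * count (vertexNbhd G v) ≤ b) →
                   ∀ S → a * count (closedNbhd G S) ≤ count S * b
count-closedNbhd {a} G bound S = count-⋃ {a = a} S (vertexNbhd G) (λ v _ → bound v)

degree<count-vertexNbhd : (G : Graph) (v : Fin (n G)) → count (adj G v) < count (vertexNbhd G v)
degree<count-vertexNbhd G v =
  count-mono-< (λ _ → from T-∨ ∘ inj₂) v (λ v~v → subst T (irrefl G v) v~v) (∈vertexNbhd G v)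

count-vertexNbhd<count-closedNbhd-pair : (G : Graph) (g w : Fin (n G)) → ¬ T (vertexNbhd G g w) →
  count (vertexNbhd G g) < count (closedNbhd G (⁅ g ⁆ ∪ ⁅ w ⁆))
count-vertexNbhd<count-closedNbhd-pair G g w w∉N[g] =
  count-mono-< (vertexNbhd⊆closedNbhd G (⁅ g ⁆ ∪ ⁅ w ⁆) (from T-∨ (inj₁ (∈⁅⁆ g)))) w w∉N[g]
    (vertexNbhd⊆closedNbhd G (⁅ g ⁆ ∪ ⁅ w ⁆) (from (T-∨ {⁅ g ⁆ w}) (inj₂ (∈⁅⁆ w)))
      w (∈vertexNbhd G w))

γHalf-lower : ∀ G {k} → γHalf≡ G k → (S : VSet (n G)) → count S < k →
              2 * count (closedNbhd G S) < n G
γHalf-lower G (_ , minimal) S small = ≰⇒> (λ dom → <⇒≱ small (minimal S dom))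

3+2*count-vertexNbhd≤order : ∀ G {k} → γHalf≡ G k → 3 ≤ k →
                             ∀ g → 3 + 2 * count (vertexNbhd G g) ≤ n G
3+2*count-vertexNbhd≤order G {k} γ 3≤k g = begin
  3 + 2 * c                                       ≡⟨ cong suc (*-suc 2 c) ⟨
  suc (2 * suc c)                                 ≤⟨ s≤s (*-monoʳ-≤ 2 N[g]<N[g,w]) ⟩
  suc (2 * count (closedNbhd G (⁅ g ⁆ ∪ ⁅ w ⁆)))  ≤⟨ γHalf-lower G γ (⁅ g ⁆ ∪ ⁅ w ⁆) |g,w|<k ⟩
  n G                                             ∎
  where
  open ≤-Reasoning
  c = count (vertexNbhd G g)
  c<order : c < n G
  c<order = ≤-<-trans (m≤n*m c 2)
    (≤-<-trans (*-monoʳ-≤ 2 (count-mono (vertexNbhd⊆closedNbhd G ⁅ g ⁆ (∈⁅⁆ g))))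
      (γHalf-lower G γ ⁅ g ⁆ (≤-<-trans (count-⁅⁆ g) (≤-trans (s≤s (s≤s z≤n)) 3≤k))))
  w = proj₁ (count<size⇒∃∉ (vertexNbhd G g) c<order)
  N[g]<N[g,w] : c < count (closedNbhd G (⁅ g ⁆ ∪ ⁅ w ⁆))
  N[g]<N[g,w] = count-vertexNbhd<count-closedNbhd-pair G g w
    (proj₂ (count<size⇒∃∉ (vertexNbhd G g) c<order))
  |g,w|<k : count (⁅ g ⁆ ∪ ⁅ w ⁆) < k
  |g,w|<k = ≤-<-trans (count-∪ ⁅ g ⁆ ⁅ w ⁆)
    (≤-trans (s≤s (+-mono-≤ (count-⁅⁆ g) (count-⁅⁆ w))) 3≤k)

5≤order : ∀ G {k} → γHalf≡ G k → 3 ≤ k → 5 ≤ n G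
5≤order G γ@((S , _ , |S|≡k) , _) 3≤k =
  ≤-trans (+-monoʳ-≤ 3 (*-monoʳ-≤ 2 (≤-trans (s≤s z≤n) (degree<count-vertexNbhd G g))))
          (3+2*count-vertexNbhd≤order G γ 3≤k g)
  where
  g : Fin (n G)
  g = fromℕ< (≤-trans (s≤s z≤n) (≤-trans 3≤k (subst (_≤ n G) |S|≡k (count≤size S))))

-- Cartesian products

module _ (G H : Graph) where

  private
    q : Fin (n G * n H) → Fin (n G)
    q = quotient (n H)
    r : Fin (n G * n H) → Fin (n H)
    r = remainder {n G} (n H)

  count-vertexNbhd-□ : ∀ x → suc (count (vertexNbhd (G □ H) x)) ≤
                             count (vertexNbhd G (q x)) + count (vertexNbhd H (r x))
  count-vertexNbhd-□ x = begin
    suc (count (vertexNbhd (G □ H) x))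
      ≤⟨ s≤s (≤-trans (count-mono N[x]⊆layers) (count-∪ H-layer G-layer)) ⟩
    suc (count H-layer + count G-layer)
      ≤⟨ s≤s (+-mono-≤ |H-layer| |G-layer|) ⟩
    suc (count (vertexNbhd H (r x)) + count (adj G (q x)))
      ≡⟨ +-suc (count (vertexNbhd H (r x))) _ ⟨
    count (vertexNbhd H (r x)) + suc (count (adj G (q x)))
      ≤⟨ +-monoʳ-≤ _ (degree<count-vertexNbhd G (q x)) ⟩
    count (vertexNbhd H (r x)) + count (vertexNbhd G (q x))
      ≡⟨ +-comm (count (vertexNbhd H (r x))) _ ⟩
    count (vertexNbhd G (q x)) + count (vertexNbhd H (r x)) ∎
    where
    open ≤-Reasoning
    H-layer G-layer : VSet (n G * n H)
    H-layer = ⁅ q x ⁆ ⊠ vertexNbhd H (r x)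
    G-layer = adj G (q x) ⊠ ⁅ r x ⁆
    |H-layer| : count H-layer ≤ count (vertexNbhd H (r x))
    |H-layer| = ≤-trans (≤-reflexive (count-⊠ ⁅ q x ⁆ (vertexNbhd H (r x))))
      (≤-trans (*-monoˡ-≤ _ (count-⁅⁆ (q x))) (≤-reflexive (*-identityˡ _)))
    |G-layer| : count G-layer ≤ count (adj G (q x))
    |G-layer| = ≤-trans (≤-reflexive (count-⊠ (adj G (q x)) ⁅ r x ⁆))
      (≤-trans (*-monoʳ-≤ (count (adj G (q x))) (count-⁅⁆ (r x))) (≤-reflexive (*-identityʳ _)))
    N[x]⊆layers : vertexNbhd (G □ H) x ⊆ (H-layer ∪ G-layer)
    N[x]⊆layers y x~y with to (T-∨ {⁅ x ⁆ y}) x~y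
    ... | inj₁ x≡y with refl ← toWitness x≡y =
      from (T-∨ {H-layer x})
        (inj₁ (from (T-∧ {⁅ q x ⁆ (q x)}) (∈⁅⁆ (q x) , ∈vertexNbhd H (r x))))
    ... | inj₂ x-y with to (T-∨ {⁅ q x ⁆ (q y) ∧ adj H (r x) (r y)}) x-y
    ...   | inj₁ vertical with (qx≡qy , rx-ry) ← to (T-∧ {⁅ q x ⁆ (q y)}) vertical =
      from (T-∨ {H-layer y})
        (inj₁ (from (T-∧ {⁅ q x ⁆ (q y)}) (qx≡qy , from (T-∨ {⁅ r x ⁆ (r y)}) (inj₂ rx-ry))))
    ...   | inj₂ horizontal with (rx≡ry , qx-qy) ← to (T-∧ {⁅ r x ⁆ (r y)}) horizontal =
      from (T-∨ {H-layer y}) (inj₂ (from (T-∧ {adj G (q x) (q y)}) (qx-qy , rx≡ry)))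

  vertexNbhd-□-quotient : ∀ u x → T (vertexNbhd (G □ H) u x) → T (vertexNbhd G (q u) (q x))
  vertexNbhd-□-quotient u x u~x with to (T-∨ {⁅ u ⁆ x}) u~x
  ... | inj₁ u≡x with refl ← toWitness u≡x = ∈vertexNbhd G (q u)
  ... | inj₂ u-x with to (T-∨ {⁅ q u ⁆ (q x) ∧ adj H (r u) (r x)}) u-x
  ...   | inj₁ vertical =
    from (T-∨ {⁅ q u ⁆ (q x)}) (inj₁ (proj₁ (to (T-∧ {⁅ q u ⁆ (q x)}) vertical)))
  ...   | inj₂ horizontal =
    from (T-∨ {⁅ q u ⁆ (q x)}) (inj₂ (proj₂ (to (T-∧ {⁅ r u ⁆ (r x)}) horizontal)))

  closedNbhd-□⊆ : (S : VSet (n G * n H)) → closedNbhd (G □ H) S ⊆ (closedNbhd G (image q S) ∘ q)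
  closedNbhd-□⊆ S x x∈N[S]
    with (u , u∈S∧u~x) ← anyF-elim _ x∈N[S]
    with (u∈S , u~x) ← to (T-∧ {S u}) u∈S∧u~x =
    vertexNbhd⊆closedNbhd G (image q S) (anyF-intro _ u (from (T-∧ {S u}) (u∈S , ∈⁅⁆ (q u))))
      (q x) (vertexNbhd-□-quotient u x u~x)

  halfDominating-image : 1 ≤ n H → ∀ S → HalfDominating (G □ H) S → HalfDominating G (image q S)
  halfDominating-image 1≤|H| S dom = *-cancelʳ-≤ (n G) (2 * c) (n H) {{>-nonZero 1≤|H|}} (begin
    n G * n H                         ≤⟨ dom ⟩
    2 * count (closedNbhd (G □ H) S)  ≤⟨ *-monoʳ-≤ 2 (count-mono (closedNbhd-□⊆ S)) ⟩
    2 * count (closedNbhd G (image q S) ∘ q)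
                                      ≡⟨ cong (2 *_) (count-∘quotient {n G} (closedNbhd G (image q S))) ⟩
    2 * (c * n H)                     ≡⟨ *-assoc 2 c (n H) ⟨
    2 * c * n H                       ∎)
    where
    open ≤-Reasoning
    c = count (closedNbhd G (image q S))

  γHalf≤γHalf-□ : ∀ {k j} → γHalf≡ G k → 1 ≤ n H → γHalf≡ (G □ H) j → k ≤ j
  γHalf≤γHalf-□ (_ , minimal) 1≤|H| ((S , dom , |S|≡j) , _) =
    ≤-trans (minimal _ (halfDominating-image 1≤|H| S dom))
            (subst (count (image q S) ≤_) |S|≡j (count-image q S))

-- Paths

count-vertexNbhd-Path : ∀ m (h : Fin m) → count (vertexNbhd (Path m) h) ≤ 3
count-vertexNbhd-Path m h = begin
  count (⁅ h ⁆ ∪ (right ∪ left))       ≤⟨ count-∪ ⁅ h ⁆ (right ∪ left) ⟩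
  count ⁅ h ⁆ + count (right ∪ left)   ≤⟨ +-mono-≤ (count-⁅⁆ h) (count-∪ right left) ⟩
  1 + (count right + count left)       ≤⟨ +-monoʳ-≤ 1 (+-mono-≤ |right| |left|) ⟩
  3                                    ∎
  where
  open ≤-Reasoning
  right left : VSet m
  right u = ⌊ suc (toℕ h) ℕ≟ toℕ u ⌋
  left  u = ⌊ suc (toℕ u) ℕ≟ toℕ h ⌋
  |right| : count right ≤ 1
  |right| = count≤1 right λ i j i∈ j∈ →
    toℕ-injective (trans (sym (toWitness i∈)) (toWitness j∈))
  |left| : count left ≤ 1
  |left| = count≤1 left λ i j i∈ j∈ →
    toℕ-injective (ℕ-suc-injective (trans (toWitness i∈) (sym (toWitness j∈))))

2*count-vertexNbhd-□Path≤1+order : ∀ G {k} m → γHalf≡ G k → 3 ≤ k →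
  ∀ x → 2 * count (vertexNbhd (G □ Path m) x) ≤ 1 + n G
2*count-vertexNbhd-□Path≤1+order G m γ 3≤k x = +-cancelˡ-≤ 2 _ _ (begin
  2 + 2 * c          ≡⟨ *-suc 2 c ⟨
  2 * suc c          ≤⟨ *-monoʳ-≤ 2 (count-vertexNbhd-□ G (Path m) x) ⟩
  2 * (a + p)        ≤⟨ *-monoʳ-≤ 2 (+-monoʳ-≤ a (count-vertexNbhd-Path m (remainder {n G} m x))) ⟩
  2 * (a + 3)        ≡⟨ regroup a ⟩
  3 + (3 + 2 * a)    ≤⟨ +-monoʳ-≤ 3 (3+2*count-vertexNbhd≤order G γ 3≤k (quotient m x)) ⟩
  3 + n G            ∎)
  where
  open ≤-Reasoning
  c = count (vertexNbhd (G □ Path m) x)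
  a = count (vertexNbhd G (quotient m x))
  p = count (vertexNbhd (Path m) (remainder {n G} m x))
  regroup : ∀ a → 2 * (a + 3) ≡ 3 + (3 + 2 * a)
  regroup = solve-∀

data Near (t : ℕ → Bool) : ℕ → Set where
  bySelf  : ∀ {i} → T (t i)       → Near t i
  byLeft  : ∀ {i} → T (t i)       → Near t (suc i)
  byRight : ∀ {i} → T (t (suc i)) → Near t i

pattern 6+_ i = suc (suc (suc (suc (suc (suc i)))))

Near-6+ : ∀ {t i} → Near (λ j → t (6+ j)) i → Near t (6+ i)
Near-6+ (bySelf p)  = bySelf p
Near-6+ (byLeft p)  = byLeft p
Near-6+ (byRight p) = byRight p

Near⇒dominated : ∀ {t m} → ¬ T (t m) → (v : Fin m) → ∀ {i} → Near t i → toℕ v ≡ i →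
                 T (closedNbhd (Path m) (t ∘ toℕ) v)
Near⇒dominated {t} {m} _ v (bySelf v∈t) refl =
  vertexNbhd⊆closedNbhd (Path m) (t ∘ toℕ) v∈t v (∈vertexNbhd (Path m) v)
Near⇒dominated {t} {m} _ v (byLeft {i} i∈t) v≡1+i =
  vertexNbhd⊆closedNbhd (Path m) (t ∘ toℕ) (subst (T ∘ t) (sym u≡i) i∈t) v
    (from (T-∨ {⁅ u ⁆ v}) (inj₂ (from (T-∨ {⌊ suc (toℕ u) ℕ≟ toℕ v ⌋})
      (inj₁ (fromWitness (trans (cong suc u≡i) (sym v≡1+i)))))))
  where
  i<m : i < m
  i<m = <-trans (n<1+n i) (subst (_< m) v≡1+i (toℕ<n v))
  u = fromℕ< i<m
  u≡i : toℕ u ≡ i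
  u≡i = toℕ-fromℕ< i<m
Near⇒dominated {t} {m} m∉t v (byRight 1+v∈t) refl =
  vertexNbhd⊆closedNbhd (Path m) (t ∘ toℕ) (subst (T ∘ t) (sym u≡1+v) 1+v∈t) v
    (from (T-∨ {⁅ u ⁆ v}) (inj₂ (from (T-∨ {⌊ suc (toℕ u) ℕ≟ toℕ v ⌋})
      (inj₂ (fromWitness (sym u≡1+v))))))
  where
  1+v<m : suc (toℕ v) < m
  1+v<m = ≤∧≢⇒< (toℕ<n v) (λ 1+v≡m → m∉t (subst (T ∘ t) 1+v≡m 1+v∈t))
  u = fromℕ< 1+v<m
  u≡1+v : toℕ u ≡ suc (toℕ v)
  u≡1+v = toℕ-fromℕ< 1+v<m

halfDominating-Path : ∀ {t} Q m → (∀ i → T (Q i) → Near t i) → ¬ T (t m) →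
                      m ≤ 2 * count {m} (Q ∘ toℕ) → HalfDominating (Path m) (t ∘ toℕ)
halfDominating-Path Q m near m∉t m≤2|Q| =
  ≤-trans m≤2|Q| (*-monoʳ-≤ 2 (count-mono λ v v∈Q → Near⇒dominated m∉t v (near (toℕ v) v∈Q) refl))

-- The vertices ≡ 1 (mod 6) dominate the residues 0, 1, 2, except that for m ≡ 1 (mod 6) the
-- last vertex m - 1 would need the missing vertex m; then the vertices ≡ 0 (mod 6) are used,
-- dominating the residues 5, 0, 1, which also cover half of P_m in that case.

≡1mod6 ∈012mod6 ≡0mod6 ∈501mod6 : ℕ → Bool
≡1mod6 1      = true
≡1mod6 (6+ i) = ≡1mod6 i
≡1mod6 _      = false

∈012mod6 0      = true
∈012mod6 1      = true
∈012mod6 2      = true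
∈012mod6 (6+ i) = ∈012mod6 i
∈012mod6 _      = false

≡0mod6 0      = true
≡0mod6 (6+ i) = ≡0mod6 i
≡0mod6 _      = false

∈501mod6 0      = true
∈501mod6 1      = true
∈501mod6 5      = true
∈501mod6 (6+ i) = ∈501mod6 i
∈501mod6 _      = false

Near-≡1mod6 : ∀ i → T (∈012mod6 i) → Near ≡1mod6 i
Near-≡1mod6 0      _ = byRight _
Near-≡1mod6 1      _ = bySelf _
Near-≡1mod6 2      _ = byLeft _
Near-≡1mod6 (6+ i) p = Near-6+ (Near-≡1mod6 i p)

Near-≡0mod6 : ∀ i → T (∈501mod6 i) → Near ≡0mod6 i
Near-≡0mod6 0      _ = bySelf _
Near-≡0mod6 1      _ = byLeft _
Near-≡0mod6 5      _ = byRight _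
Near-≡0mod6 (6+ i) p = Near-6+ (Near-≡0mod6 i p)

≡1mod6⇒≢0mod6 : ∀ i → T (≡1mod6 i) → ¬ T (≡0mod6 i)
≡1mod6⇒≢0mod6 (6+ i) = ≡1mod6⇒≢0mod6 i

count-≡1mod6 : ∀ m → 6 * count {m} (≡1mod6 ∘ toℕ) ≤ m + 5
count-≡1mod6 (6+ m) =
  ≤-trans (≤-reflexive (*-suc 6 (count {m} (≡1mod6 ∘ toℕ)))) (+-monoʳ-≤ 6 (count-≡1mod6 m))
count-≡1mod6 0 = ≤ᵇ⇒≤ _ _ _
count-≡1mod6 1 = ≤ᵇ⇒≤ _ _ _
count-≡1mod6 2 = ≤ᵇ⇒≤ _ _ _
count-≡1mod6 3 = ≤ᵇ⇒≤ _ _ _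
count-≡1mod6 4 = ≤ᵇ⇒≤ _ _ _
count-≡1mod6 5 = ≤ᵇ⇒≤ _ _ _

count-≡0mod6 : ∀ m → 6 * count {m} (≡0mod6 ∘ toℕ) ≤ m + 5
count-≡0mod6 (6+ m) =
  ≤-trans (≤-reflexive (*-suc 6 (count {m} (≡0mod6 ∘ toℕ)))) (+-monoʳ-≤ 6 (count-≡0mod6 m))
count-≡0mod6 0 = ≤ᵇ⇒≤ _ _ _
count-≡0mod6 1 = ≤ᵇ⇒≤ _ _ _
count-≡0mod6 2 = ≤ᵇ⇒≤ _ _ _
count-≡0mod6 3 = ≤ᵇ⇒≤ _ _ _
count-≡0mod6 4 = ≤ᵇ⇒≤ _ _ _
count-≡0mod6 5 = ≤ᵇ⇒≤ _ _ _

count-∈012mod6 : ∀ m → m ≤ 2 * count {m} (∈012mod6 ∘ toℕ)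
count-∈012mod6 (6+ m) =
  ≤-trans (+-monoʳ-≤ 6 (count-∈012mod6 m))
          (≤-reflexive (sym (*-distribˡ-+ 2 3 (count {m} (∈012mod6 ∘ toℕ)))))
count-∈012mod6 0 = ≤ᵇ⇒≤ _ _ _
count-∈012mod6 1 = ≤ᵇ⇒≤ _ _ _
count-∈012mod6 2 = ≤ᵇ⇒≤ _ _ _
count-∈012mod6 3 = ≤ᵇ⇒≤ _ _ _
count-∈012mod6 4 = ≤ᵇ⇒≤ _ _ _
count-∈012mod6 5 = ≤ᵇ⇒≤ _ _ _

count-∈501mod6 : ∀ m → T (≡1mod6 m) → m ≤ 2 * count {m} (∈501mod6 ∘ toℕ)
count-∈501mod6 (6+ m) m≡1 =
  ≤-trans (+-monoʳ-≤ 6 (count-∈501mod6 m m≡1))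
          (≤-reflexive (sym (*-distribˡ-+ 2 3 (count {m} (∈501mod6 ∘ toℕ)))))
count-∈501mod6 1 _ = ≤ᵇ⇒≤ _ _ _

Path-halfDominatingSet : ∀ m → ∃ λ D → HalfDominating (Path m) D × 6 * count D ≤ m + 5
Path-halfDominatingSet m with T? (≡1mod6 m)
... | no  m≢1 = ≡1mod6 ∘ toℕ
              , halfDominating-Path ∈012mod6 m Near-≡1mod6 m≢1 (count-∈012mod6 m)
              , count-≡1mod6 m
... | yes m≡1 = ≡0mod6 ∘ toℕ
              , halfDominating-Path ∈501mod6 m Near-≡0mod6 (≡1mod6⇒≢0mod6 m m≡1) (count-∈501mod6 m m≡1)
              , count-≡0mod6 m

-- Arithmetic

5m≤6j : ∀ n m j → 5 ≤ n → n * m ≤ j * (1 + n) → 5 * m ≤ 6 * j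
5m≤6j n m j 5≤n nm≤j[1+n] = *-cancelʳ-≤ (5 * m) (6 * j) (1 + n) (begin
  5 * m * (1 + n)         ≡⟨ expand m n ⟩
  5 * m + 5 * (n * m)     ≤⟨ +-monoˡ-≤ (5 * (n * m)) (*-monoˡ-≤ m 5≤n) ⟩
  6 * (n * m)             ≤⟨ *-monoʳ-≤ 6 nm≤j[1+n] ⟩
  6 * (j * (1 + n))       ≡⟨ *-assoc 6 j (1 + n) ⟨
  6 * j * (1 + n)         ∎)
  where
  open ≤-Reasoning
  expand : ∀ m n → 5 * m * (1 + n) ≡ 5 * m + 5 * (n * m)
  expand = solve-∀

3k≤j : ∀ m j k → 5 * m ≤ 6 * j → 3 ≤ j → 6 * k ≤ m + 5 → 3 * k ≤ j
3k≤j m j k 5m≤6j 3≤j 6k≤m+5 with 5 ≤? m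
... | no  m≱5 = ≤-trans (*-monoʳ-≤ 3 (≤-pred k<2)) 3≤j
  where
  k<2 : k < 2
  k<2 = *-cancelˡ-< 6 k 2
    (≤-<-trans 6k≤m+5 (≤-<-trans (+-monoˡ-≤ 5 (≤-pred (≰⇒> m≱5))) (≤ᵇ⇒≤ _ _ _)))
... | yes 5≤m = ≤-pred (*-cancelˡ-< 6 (3 * k) (suc j) (begin-strict
  6 * (3 * k)          ≡⟨ regroup₁ k ⟩
  3 * (6 * k)          ≤⟨ *-monoʳ-≤ 3 6k≤m+5 ⟩
  3 * (m + 5)          ≡⟨ regroup₂ m ⟩
  3 * m + 5 + 2 * 5    ≤⟨ +-monoʳ-≤ (3 * m + 5) (*-monoʳ-≤ 2 5≤m) ⟩
  3 * m + 5 + 2 * m    ≡⟨ regroup₃ m ⟩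
  5 * m + 5            ≤⟨ +-monoˡ-≤ 5 5m≤6j ⟩
  6 * j + 5            <⟨ n<1+n _ ⟩
  suc (6 * j + 5)      ≡⟨ regroup₄ j ⟩
  6 * suc j            ∎))
  where
  open ≤-Reasoning
  regroup₁ : ∀ k → 6 * (3 * k) ≡ 3 * (6 * k)
  regroup₁ = solve-∀
  regroup₂ : ∀ m → 3 * (m + 5) ≡ 3 * m + 5 + 2 * 5
  regroup₂ = solve-∀
  regroup₃ : ∀ m → 3 * m + 5 + 2 * m ≡ 5 * m + 5
  regroup₃ = solve-∀
  regroup₄ : ∀ j → suc (6 * j + 5) ≡ 6 * suc j
  regroup₄ = solve-∀

mainTheorem7 : (G : Graph) (m k : ℕ) → 1 ≤ m
    → γHalf≡ G 3 → γHalf≡ (Path m) k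
    → ∀ j → γHalf≡ (G □ Path m) j → 3 * k ≤ j
mainTheorem7 G m k 1≤m γG (_ , P-minimal) j γ□@((S , S-dom , |S|≡j) , _) =
  3k≤j m j k (5m≤6j (n G) m j (5≤order G γG ≤-refl) nm≤j[1+n])
             (γHalf≤γHalf-□ G (Path m) γG 1≤m γ□)
             6k≤m+5
  where
  nm≤j[1+n] : n G * m ≤ j * (1 + n G)
  nm≤j[1+n] = ≤-trans S-dom
    (subst (λ s → 2 * count (closedNbhd (G □ Path m) S) ≤ s * (1 + n G)) |S|≡j
      (count-closedNbhd {2} (G □ Path m) (2*count-vertexNbhd-□Path≤1+order G m γG ≤-refl) S))
  6k≤m+5 : 6 * k ≤ m + 5
  6k≤m+5 with (D , D-dom , 6|D|≤m+5) ← Path-halfDominatingSet m =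
    ≤-trans (*-monoʳ-≤ 6 (P-minimal D D-dom)) 6|D|≤m+5
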